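{- Let $b,x_1,x_2$ be positive integers and $y_1,y_2$ integers with $0\le y_1<2b$, $0<y_2<2b$, $\gcd\{x_1,x_2\}=1$ and $\gcd\{b,y_1,y_2\}=1$, and assume there is no integer $k$ with either ($k$ odd, $x_2=kx_1$, $y_2\equiv ky_1 \pmod{2b}$) or ($k$ even, $x_2=kx_1$, $y_2\equiv ky_1+b\pmod{2b}$). Suppose $y_1+y_2=2b$. Then $L(b;x_1,y_1;x_2,y_2)$ has diagonal periodicity. In particular, it has no horizontal preperiod and horizontal period $x_1+x_2$.
   Context: The Lengyel transfer game $L(b;x_1,y_1;x_2,y_2)$ is the impartial normal-play game on positions $(x,y)\in\mathbb{N}^2$ in which a move consists of adding one of $(0,-b)$, $(-x_1,y_1)$, $(-x_2,y_2)$, provided the result lies in $\mathbb{N}^2$; $\mathcal{SG}(x,y)$ is the Sprague–Grundy value. Let $\mathcal{SG}^*(x,y)=\mathcal{SG}(x,y)$ if $\mathcal{SG}(x,y)\in\{0,1,2\}$ and $\mathcal{SG}^*(x,y)=2$ if $\mathcal{SG}(x,y)=3$. The game has diagonal periodicity if for all $(x,y)$ with $y\ge y_1+y_2$, $\mathcal{SG}^*(x,y)=\mathcal{SG}^*(x+x_1+x_2,\,y-y_1-y_2)$. Horizontal period $p$ with no preperiod means $\mathcal{SG}(x+p,y)=\mathcal{SG}(x,y)$ for all $(x,y)\in\mathbb{N}^2$. -}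

module Defs where

open import Data.Nat using (ℕ; zero; suc; _+_; _*_; _∸_; _≤_; _<_; _≤ᵇ_; _≡ᵇ_)
open import Data.Nat.GCD using (gcd)
open import Data.Nat.DivMod using (_%_)
open import Data.Integer as ℤ using (ℤ; +_)
open import Data.Integer.Divisibility as ℤ∣ using ()
open import Data.Bool using (Bool; true; false; if_then_else_)
open import Data.List using (List; []; _∷_; length)
open import Data.Product using (_×_; ∃-syntax)
open import Relation.Binary.PropositionalEquality using (_≡_)
open import Relation.Nullary using (¬_)

elemᵇ : ℕ → List ℕ → Bool
elemᵇ n []       = false
elemᵇ n (m ∷ ms) = if n ≡ᵇ m then true else elemᵇ n ms

-- mex: least natural number not in the list
-- (searching 0,1,...,length l suffices: one of these is missing)
mexFrom : ℕ → ℕ → List ℕ → ℕ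
mexFrom n zero    l = n
mexFrom n (suc f) l = if elemᵇ n l then mexFrom (suc n) f l else n

mex : List ℕ → ℕ
mex l = mexFrom 0 (length l) l

-- Options of (x , y): add (0,-b), (-x1,y1), (-x2,y2), staying in ℕ².
-- sgFuel computes the Sprague–Grundy value by recursion on a fuel
-- parameter; the honest SG value is obtained with enough fuel.
sgFuel : (b x₁ y₁ x₂ y₂ : ℕ) → ℕ → ℕ → ℕ → ℕ
sgFuel b x₁ y₁ x₂ y₂ zero    x y = 0
sgFuel b x₁ y₁ x₂ y₂ (suc f) x y = mex (o₀ (o₁ (o₂ [])))
  where
  rec = sgFuel b x₁ y₁ x₂ y₂ f
  o₀ : List ℕ → List ℕ
  o₀ l = if b ≤ᵇ y then rec x (y ∸ b) ∷ l else l
  o₁ : List ℕ → List ℕ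
  o₁ l = if x₁ ≤ᵇ x then rec (x ∸ x₁) (y + y₁) ∷ l else l
  o₂ : List ℕ → List ℕ
  o₂ l = if x₂ ≤ᵇ x then rec (x ∸ x₂) (y + y₂) ∷ l else l

-- Every move strictly decreases the
-- measure 2b·x + y whenever b ≥ 1, x1,x2 ≥ 1, y1,y2 < 2b (the standing
-- hypotheses of the theorem), so fuel 2b·x + y + 1 suffices and this
-- equals the true Sprague–Grundy value under those hypotheses.
SG : (b x₁ y₁ x₂ y₂ : ℕ) → ℕ → ℕ → ℕ
SG b x₁ y₁ x₂ y₂ x y = sgFuel b x₁ y₁ x₂ y₂ (suc (2 * b * x + y)) x y

star : ℕ → ℕ
star 3 = 2
star n = n

SG* : (b x₁ y₁ x₂ y₂ : ℕ) → ℕ → ℕ → ℕ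
SG* b x₁ y₁ x₂ y₂ x y = star (SG b x₁ y₁ x₂ y₂ x y)

infix 4 _≡_[mod_]
_≡_[mod_] : ℕ → ℕ → ℕ → Set
m ≡ n [mod d ] = (+ d) ℤ∣.∣ ((+ m) ℤ.- (+ n))

DiagonalPeriodic : (b x₁ y₁ x₂ y₂ : ℕ) → Set
DiagonalPeriodic b x₁ y₁ x₂ y₂ =
  ∀ x y → y₁ + y₂ ≤ y →
    SG* b x₁ y₁ x₂ y₂ x y ≡ SG* b x₁ y₁ x₂ y₂ (x + (x₁ + x₂)) (y ∸ (y₁ + y₂))

HorizontalPeriodNoPreperiod : (b x₁ y₁ x₂ y₂ : ℕ) → ℕ → Set
HorizontalPeriodNoPreperiod b x₁ y₁ x₂ y₂ p =
  ∀ x y → SG b x₁ y₁ x₂ y₂ (x + p) y ≡ SG b x₁ y₁ x₂ y₂ x y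

Degenerate : (b x₁ y₁ x₂ y₂ : ℕ) → Set
Degenerate b x₁ y₁ x₂ y₂ =
  ∃[ k ] ((k % 2 ≡ 1 × x₂ ≡ k * x₁ × (y₂ ≡ k * y₁ [mod 2 * b ]))
         Data.Sum.⊎ (k % 2 ≡ 0 × x₂ ≡ k * x₁ × (y₂ ≡ k * y₁ + b [mod 2 * b ])))
  where import Data.Sum

-- Both periodicities are proved by induction along moves, comparing option sets: SG q = SG p
-- as soon as every option value of p is one of q and every other option value of q differs
-- from SG p.  Moving (x , y) up to (x , y + 2b) adds exactly the option (x , y + b), which
-- has (x , y) as an option and so has a different value.  When y₁ + y₂ = 2b, moving (x , y)
-- right to (x + x₁ + x₂ , y) adds the options (x + x₂ , y + y₁) and (x + x₁ , y + y₂), which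
-- both move to (x , y + 2b), a position with the value of (x , y) by vertical periodicity.
-- Diagonal periodicity combines the two.  Only b, x₁, x₂ > 0 and y₁, y₂ < 2b (which make the
-- game terminate) and y₁ + y₂ = 2b are used; the gcd and non-degeneracy conditions are not.
module Submission where

open import Defs
open import Data.Bool using (Bool; true; false; if_then_else_; T)
open import Data.Fin using (Fin; toℕ)
open import Data.Fin.Properties using (toℕ<n; toℕ-injective; injective⇒≤)
open import Data.List using (List; []; _∷_; length; lookup)
open import Data.List.Membership.Propositional using (_∈_; _∉_)
open import Data.List.Relation.Binary.Subset.Propositional using (_⊆_)
open import Data.List.Relation.Unary.Any using (here; there; index)
open import Data.List.Relation.Unary.Any.Properties using (lookup-index)
open import Data.Nat using (ℕ; zero; suc; _+_; _*_; _∸_; _≤_; _<_; _≤ᵇ_; _≡ᵇ_; s≤s; >-nonZero)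
open import Data.Nat.GCD using (gcd)
open import Data.Nat.Induction using (<-wellFounded)
open import Data.Nat.Properties
open import Data.Product using (_×_; _,_; proj₁; proj₂)
open import Data.Sum as Sum using (_⊎_; inj₁; inj₂)
open import Data.Unit using (tt)
open import Induction.WellFounded using (Acc; acc)
open import Relation.Binary.PropositionalEquality
open import Relation.Nullary using (¬_)
open import Relation.Nullary.Reflects using (Reflects; ofʸ; ofⁿ)
open import Algebra.Properties.CommutativeSemigroup +-commutativeSemigroup
  using (xy∙z≈xz∙y; x∙yz≈xz∙y)

elemᵇ-reflects : ∀ n l → Reflects (n ∈ l) (elemᵇ n l)
elemᵇ-reflects n []      = ofⁿ λ ()
elemᵇ-reflects n (m ∷ l) with n ≡ᵇ m in n≡ᵇm
... | true  = ofʸ (here (≡ᵇ⇒≡ n m (subst T (sym n≡ᵇm) tt)))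
... | false with elemᵇ n l | elemᵇ-reflects n l
...   | true  | ofʸ n∈l = ofʸ (there n∈l)
...   | false | ofⁿ n∉l = ofⁿ λ where
        (here n≡m)  → subst T n≡ᵇm (≡⇒≡ᵇ n m n≡m)
        (there n∈l) → n∉l n∈l

InitialSegment⊆ : ℕ → List ℕ → Set
InitialSegment⊆ n l = ∀ {k} → k < n → k ∈ l

initialSegment⊆⇒≤length : ∀ {n l} → InitialSegment⊆ n l → n ≤ length l
initialSegment⊆⇒≤length {n} {l} below = injective⇒≤ position-injective
  where
  position : Fin n → Fin (length l)
  position i = index (below (toℕ<n i))
  position-injective : ∀ {i j} → position i ≡ position j → i ≡ j
  position-injective {i} {j} eq = toℕ-injective (begin
    toℕ i                  ≡⟨ lookup-index (below (toℕ<n i)) ⟩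
    lookup l (position i)  ≡⟨ cong (lookup l) eq ⟩
    lookup l (position j)  ≡⟨ lookup-index (below (toℕ<n j)) ⟨
    toℕ j                  ∎)
    where open ≡-Reasoning

initialSegment⊆-suc : ∀ {n l} → InitialSegment⊆ n l → n ∈ l → InitialSegment⊆ (suc n) l
initialSegment⊆-suc below n∈l k<1+n with m<1+n⇒m<n∨m≡n k<1+n
... | inj₁ k<n  = below k<n
... | inj₂ refl = n∈l

IsMex : List ℕ → ℕ → Set
IsMex l m = m ∉ l × InitialSegment⊆ m l

IsMex-unique : ∀ {l m m′} → IsMex l m → IsMex l m′ → m ≡ m′
IsMex-unique (m∉l , below) (m′∉l , below′) =
  ≤-antisym (≮⇒≥ λ m′<m → m′∉l (below m′<m)) (≮⇒≥ λ m<m′ → m∉l (below′ m<m′))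

mexFrom-isMex : ∀ f {n l} → length l ≤ n + f → InitialSegment⊆ n l → IsMex l (mexFrom n f l)
mexFrom-isMex zero {n} {l} l≤n+0 below = n∉l , below
  where
  n∉l : n ∉ l
  n∉l n∈l = <⇒≱ (≤-trans (initialSegment⊆⇒≤length (initialSegment⊆-suc below n∈l))
                         (subst (length l ≤_) (+-identityʳ n) l≤n+0)) ≤-refl
mexFrom-isMex (suc f) {n} {l} l≤n+1+f below with elemᵇ n l | elemᵇ-reflects n l
... | true  | ofʸ n∈l = mexFrom-isMex f (subst (length l ≤_) (+-suc n f) l≤n+1+f)
                                       (initialSegment⊆-suc below n∈l)
... | false | ofⁿ n∉l = n∉l , below

mex-isMex : ∀ l → IsMex l (mex l)
mex-isMex l = mexFrom-isMex (length l) ≤-refl λ ()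

mex∉ : ∀ l → mex l ∉ l
mex∉ l = proj₁ (mex-isMex l)

mex-cong : ∀ {l l′} → l ⊆ l′ → (∀ {n} → n ∈ l′ → n ∈ l ⊎ n ≢ mex l) → mex l′ ≡ mex l
mex-cong {l} {l′} l⊆l′ l′⊆l∪≢mex =
  IsMex-unique (mex-isMex l′) (mex∉l′ , λ k<mex → l⊆l′ (proj₂ (mex-isMex l) k<mex))
  where
  mex∉l′ : mex l ∉ l′
  mex∉l′ mex∈l′ with l′⊆l∪≢mex mex∈l′
  ... | inj₁ mex∈l  = mex∉ l mex∈l
  ... | inj₂ mex≢mex = mex≢mex refl

guard : ∀ {A : Set} → Bool → A → List A → List A
guard c v l = if c then v ∷ l else l

∈-guard⁻ : ∀ {A : Set} c {v n : A} {l} → n ∈ guard c v l → (T c × n ≡ v) ⊎ n ∈ l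
∈-guard⁻ true  (here n≡v)  = inj₁ (tt , n≡v)
∈-guard⁻ true  (there n∈l) = inj₂ n∈l
∈-guard⁻ false n∈l         = inj₂ n∈l

∈-guard⁺ˡ : ∀ {A : Set} {c} {v n : A} {l} → T c → n ≡ v → n ∈ guard c v l
∈-guard⁺ˡ {c = true} _ n≡v = here n≡v

∈-guard⁺ʳ : ∀ {A : Set} c {v n : A} {l} → n ∈ l → n ∈ guard c v l
∈-guard⁺ʳ true  n∈l = there n∈l
∈-guard⁺ʳ false n∈l = n∈l

guard-cong : ∀ {A : Set} c {v v′ : A} {l l′} →
             (T c → v ≡ v′) → l ≡ l′ → guard c v l ≡ guard c v′ l′
guard-cong true  v≡v′ refl = cong (_∷ _) (v≡v′ tt)
guard-cong false _    l≡l′ = l≡l′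

module LengyelGame (b x₁ y₁ x₂ y₂ : ℕ) where

  data Move (x y : ℕ) : ℕ → ℕ → Set where
    drop      : ∀ {y′} → y ≡ y′ + b  → Move x y x y′
    transfer₁ : ∀ {x′} → x ≡ x′ + x₁ → Move x y x′ (y + y₁)
    transfer₂ : ∀ {x′} → x ≡ x′ + x₂ → Move x y x′ (y + y₂)

  AllOptions : (ℕ → ℕ → Set) → ℕ → ℕ → Set
  AllOptions P x y = ∀ {x′ y′} → Move x y x′ y′ → P x′ y′

  data OptionValue (r : ℕ → ℕ → ℕ) (x y n : ℕ) : Set where
    option : ∀ {x′ y′} → Move x y x′ y′ → r x′ y′ ≡ n → OptionValue r x y n

  -- The list built in the body of sgFuel, so that sgFuel (suc f) x y and
  -- mex (options (sgFuel f) x y) are definitionally equal.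
  options : (ℕ → ℕ → ℕ) → ℕ → ℕ → List ℕ
  options r x y = guard (b ≤ᵇ y)  (r x (y ∸ b))
                 (guard (x₁ ≤ᵇ x) (r (x ∸ x₁) (y + y₁))
                 (guard (x₂ ≤ᵇ x) (r (x ∸ x₂) (y + y₂)) []))

  ∈-options⁻ : ∀ {r x y n} → n ∈ options r x y → OptionValue r x y n
  ∈-options⁻ {x = x} {y} n∈ with ∈-guard⁻ (b ≤ᵇ y) n∈
  ... | inj₁ (b≤y , refl) = option (drop (sym (m∸n+n≡m (≤ᵇ⇒≤ b y b≤y)))) refl
  ... | inj₂ n∈′ with ∈-guard⁻ (x₁ ≤ᵇ x) n∈′
  ...   | inj₁ (x₁≤x , refl) = option (transfer₁ (sym (m∸n+n≡m (≤ᵇ⇒≤ x₁ x x₁≤x)))) refl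
  ...   | inj₂ n∈″ with ∈-guard⁻ (x₂ ≤ᵇ x) n∈″
  ...     | inj₁ (x₂≤x , refl) = option (transfer₂ (sym (m∸n+n≡m (≤ᵇ⇒≤ x₂ x x₂≤x)))) refl
  ...     | inj₂ ()

  ∈-options⁺ : ∀ {r x y n} → OptionValue r x y n → n ∈ options r x y
  ∈-options⁺ {r} (option (drop {y′} refl) refl) =
    ∈-guard⁺ˡ (≤⇒≤ᵇ (m≤n+m b y′)) (cong (r _) (sym (m+n∸n≡m y′ b)))
  ∈-options⁺ {r} {y = y} (option (transfer₁ {x′} refl) refl) =
    ∈-guard⁺ʳ (b ≤ᵇ y)
      (∈-guard⁺ˡ (≤⇒≤ᵇ (m≤n+m x₁ x′)) (cong (λ u → r u (y + y₁)) (sym (m+n∸n≡m x′ x₁))))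
  ∈-options⁺ {r} {y = y} (option (transfer₂ {x′} refl) refl) =
    ∈-guard⁺ʳ (b ≤ᵇ y) (∈-guard⁺ʳ (x₁ ≤ᵇ x′ + x₂)
      (∈-guard⁺ˡ (≤⇒≤ᵇ (m≤n+m x₂ x′)) (cong (λ u → r u (y + y₂)) (sym (m+n∸n≡m x′ x₂)))))

  options-cong : ∀ {r r′ x y} → AllOptions (λ u v → r u v ≡ r′ u v) x y →
                 options r x y ≡ options r′ x y
  options-cong {x = x} {y} r≡r′ =
    guard-cong (b ≤ᵇ y)  (λ b≤y  → r≡r′ (drop (sym (m∸n+n≡m (≤ᵇ⇒≤ b y b≤y)))))
   (guard-cong (x₁ ≤ᵇ x) (λ x₁≤x → r≡r′ (transfer₁ (sym (m∸n+n≡m (≤ᵇ⇒≤ x₁ x x₁≤x)))))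
   (guard-cong (x₂ ≤ᵇ x) (λ x₂≤x → r≡r′ (transfer₂ (sym (m∸n+n≡m (≤ᵇ⇒≤ x₂ x x₂≤x))))) refl))

  sg : ℕ → ℕ → ℕ
  sg = SG b x₁ y₁ x₂ y₂

  measure : ℕ → ℕ → ℕ
  measure x y = 2 * b * x + y

  module Terminating (0<b : 0 < b) (0<x₁ : 0 < x₁) (0<x₂ : 0 < x₂)
                     (y₁<2b : y₁ < 2 * b) (y₂<2b : y₂ < 2 * b) where

    transfer-decreases : ∀ {dx dy} x y → 0 < dx → dy < 2 * b →
                         measure x (y + dy) < measure (x + dx) y
    transfer-decreases {dx} {dy} x y 0<dx dy<2b = begin-strict
      2 * b * x + (y + dy)          ≡⟨ cong (2 * b * x +_) (+-comm y dy) ⟩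
      2 * b * x + (dy + y)          <⟨ +-monoʳ-< (2 * b * x) (+-monoˡ-< y dy<2b) ⟩
      2 * b * x + (2 * b + y)       ≤⟨ +-monoʳ-≤ (2 * b * x) (+-monoˡ-≤ y 2b≤2b*dx) ⟩
      2 * b * x + (2 * b * dx + y)  ≡⟨ +-assoc (2 * b * x) _ y ⟨
      2 * b * x + 2 * b * dx + y    ≡⟨ cong (_+ y) (*-distribˡ-+ (2 * b) x dx) ⟨
      2 * b * (x + dx) + y          ∎
      where
      open ≤-Reasoning
      2b≤2b*dx : 2 * b ≤ 2 * b * dx
      2b≤2b*dx = m≤m*n (2 * b) dx {{>-nonZero 0<dx}}

    move-decreases : ∀ {x y x′ y′} → Move x y x′ y′ → measure x′ y′ < measure x y
    move-decreases {x}     (drop {y′} refl)      = +-monoʳ-< (2 * b * x) (m<m+n y′ 0<b)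
    move-decreases {y = y} (transfer₁ {x′} refl) = transfer-decreases x′ y 0<x₁ y₁<2b
    move-decreases {y = y} (transfer₂ {x′} refl) = transfer-decreases x′ y 0<x₂ y₂<2b

    game-ind : (P : ℕ → ℕ → Set) → (∀ {x y} → AllOptions P x y → P x y) → ∀ x y → P x y
    game-ind P step x y = go (<-wellFounded (measure x y))
      where
      go : ∀ {x y} → Acc _<_ (measure x y) → P x y
      go (acc rs) = step λ m → go (rs (move-decreases m))

    sgFuel-irrelevant : ∀ f g {x y} → measure x y < f → measure x y < g →
                        sgFuel b x₁ y₁ x₂ y₂ f x y ≡ sgFuel b x₁ y₁ x₂ y₂ g x y
    sgFuel-irrelevant (suc f) (suc g) (s≤s μ≤f) (s≤s μ≤g) = cong mex (options-cong λ m →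
      sgFuel-irrelevant f g (<-≤-trans (move-decreases m) μ≤f) (<-≤-trans (move-decreases m) μ≤g))

    sg-unfold : ∀ x y → sg x y ≡ mex (options sg x y)
    sg-unfold x y = cong mex (options-cong λ m → sgFuel-irrelevant _ _ (move-decreases m) ≤-refl)

    sg-≢-move : ∀ {x y u v} → Move x y u v → sg x y ≢ sg u v
    sg-≢-move {x} {y} m eq = mex∉ (options sg x y)
      (subst (_∈ options sg x y) (trans (sym eq) (sg-unfold x y)) (∈-options⁺ {sg} (option m refl)))

    sg-≡-by-options : ∀ {x y x′ y′} →
      AllOptions (λ u v → OptionValue sg x′ y′ (sg u v)) x y →
      AllOptions (λ u v → OptionValue sg x y (sg u v) ⊎ sg u v ≢ sg x y) x′ y′ →
      sg x′ y′ ≡ sg x y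
    sg-≡-by-options {x} {y} {x′} {y′} forward backward = begin
      sg x′ y′                ≡⟨ sg-unfold x′ y′ ⟩
      mex (options sg x′ y′)  ≡⟨ mex-cong options⊆ options⊆options∪≢mex ⟩
      mex (options sg x y)    ≡⟨ sg-unfold x y ⟨
      sg x y                  ∎
      where
      open ≡-Reasoning
      options⊆ : options sg x y ⊆ options sg x′ y′
      options⊆ n∈ with ∈-options⁻ {sg} n∈
      ... | option m refl = ∈-options⁺ (forward m)
      options⊆options∪≢mex : ∀ {n} → n ∈ options sg x′ y′ →
                             n ∈ options sg x y ⊎ n ≢ mex (options sg x y)
      options⊆options∪≢mex n∈ with ∈-options⁻ {sg} n∈
      ... | option m refl =
        Sum.map ∈-options⁺ (λ ≢sg eq → ≢sg (trans eq (sym (sg-unfold x y)))) (backward m)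

    vertical-period : ∀ x y → sg x (y + 2 * b) ≡ sg x y
    vertical-period = game-ind VerticallyPeriodic λ ih → sg-≡-by-options (forward ih) (backward ih)
      where
      VerticallyPeriodic : ℕ → ℕ → Set
      VerticallyPeriodic x y = sg x (y + 2 * b) ≡ sg x y
      forward : ∀ {x y u v} → AllOptions VerticallyPeriodic x y →
                Move x y u v → OptionValue sg x (y + 2 * b) (sg u v)
      forward ih (drop {y′} refl) = option (drop (xy∙z≈xz∙y y′ b (2 * b))) (ih (drop refl))
      forward {y = y} ih (transfer₁ x≡) =
        option (transfer₁ x≡) (trans (cong (sg _) (xy∙z≈xz∙y y (2 * b) y₁)) (ih (transfer₁ x≡)))
      forward {y = y} ih (transfer₂ x≡) =
        option (transfer₂ x≡) (trans (cong (sg _) (xy∙z≈xz∙y y (2 * b) y₂)) (ih (transfer₂ x≡)))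
      backward : ∀ {x y u v} → AllOptions VerticallyPeriodic x y →
                 Move x (y + 2 * b) u v → OptionValue sg x y (sg u v) ⊎ sg u v ≢ sg x y
      backward {y = y} ih (drop {y′} y+2b≡) = inj₂ (sg-≢-move (drop y′≡y+b))
        where
        open ≡-Reasoning
        y′≡y+b : y′ ≡ y + b
        y′≡y+b = +-cancelʳ-≡ b y′ (y + b) (begin
          y′ + b       ≡⟨ y+2b≡ ⟨
          y + 2 * b    ≡⟨ cong (λ c → y + (b + c)) (+-identityʳ b) ⟩
          y + (b + b)  ≡⟨ +-assoc y b b ⟨
          y + b + b    ∎)
      backward {y = y} ih (transfer₁ x≡) = inj₁ (option (transfer₁ x≡)
        (sym (trans (cong (sg _) (xy∙z≈xz∙y y (2 * b) y₁)) (ih (transfer₁ x≡)))))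
      backward {y = y} ih (transfer₂ x≡) = inj₁ (option (transfer₂ x≡)
        (sym (trans (cong (sg _) (xy∙z≈xz∙y y (2 * b) y₂)) (ih (transfer₂ x≡)))))

    horizontal-period : y₁ + y₂ ≡ 2 * b → ∀ x y → sg (x + (x₁ + x₂)) y ≡ sg x y
    horizontal-period y₁+y₂≡2b =
      game-ind HorizontallyPeriodic λ ih → sg-≡-by-options (forward ih) (backward ih)
      where
      HorizontallyPeriodic : ℕ → ℕ → Set
      HorizontallyPeriodic x y = sg (x + (x₁ + x₂)) y ≡ sg x y
      forward : ∀ {x y u v} → AllOptions HorizontallyPeriodic x y →
                Move x y u v → OptionValue sg (x + (x₁ + x₂)) y (sg u v)
      forward ih (drop y≡) = option (drop y≡) (ih (drop y≡))
      forward ih (transfer₁ {x′} refl) =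
        option (transfer₁ (xy∙z≈xz∙y x′ x₁ (x₁ + x₂))) (ih (transfer₁ refl))
      forward ih (transfer₂ {x′} refl) =
        option (transfer₂ (xy∙z≈xz∙y x′ x₂ (x₁ + x₂))) (ih (transfer₂ refl))
      sg-≢-if-moves-to-+2b : ∀ {u v x y y′} → Move u v x y′ → y′ ≡ y + 2 * b → sg u v ≢ sg x y
      sg-≢-if-moves-to-+2b {x = x} {y} m refl eq =
        sg-≢-move m (trans eq (sym (vertical-period x y)))
      backward : ∀ {x y u v} → AllOptions HorizontallyPeriodic x y →
                 Move (x + (x₁ + x₂)) y u v → OptionValue sg x y (sg u v) ⊎ sg u v ≢ sg x y
      backward ih (drop y≡) = inj₁ (option (drop y≡) (sym (ih (drop y≡))))
      backward {x} {y} ih (transfer₁ {x′} x+x₁+x₂≡) = inj₂ (sg-≢-if-moves-to-+2b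
          (transfer₂ x′≡x+x₂) (trans (+-assoc y y₁ y₂) (cong (y +_) y₁+y₂≡2b)))
        where
        x′≡x+x₂ : x′ ≡ x + x₂
        x′≡x+x₂ = +-cancelʳ-≡ x₁ x′ (x + x₂) (trans (sym x+x₁+x₂≡) (x∙yz≈xz∙y x x₁ x₂))
      backward {x} {y} ih (transfer₂ {x′} x+x₁+x₂≡) = inj₂ (sg-≢-if-moves-to-+2b
          (transfer₁ x′≡x+x₁)
          (trans (xy∙z≈xz∙y y y₂ y₁) (trans (+-assoc y y₁ y₂) (cong (y +_) y₁+y₂≡2b))))
        where
        x′≡x+x₁ : x′ ≡ x + x₁
        x′≡x+x₁ = +-cancelʳ-≡ x₂ x′ (x + x₁) (trans (sym x+x₁+x₂≡) (sym (+-assoc x x₁ x₂)))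

mainTheorem10 : (b x₁ y₁ x₂ y₂ : ℕ) →
    0 < b → 0 < x₁ → 0 < x₂ →
    y₁ < 2 * b → 0 < y₂ → y₂ < 2 * b →
    gcd x₁ x₂ ≡ 1 → gcd (gcd b y₁) y₂ ≡ 1 →
    ¬ Degenerate b x₁ y₁ x₂ y₂ →
    y₁ + y₂ ≡ 2 * b →
    DiagonalPeriodic b x₁ y₁ x₂ y₂ × HorizontalPeriodNoPreperiod b x₁ y₁ x₂ y₂ (x₁ + x₂)
mainTheorem10 b x₁ y₁ x₂ y₂ 0<b 0<x₁ 0<x₂ y₁<2b _ y₂<2b _ _ _ y₁+y₂≡2b =
  diagonal , horizontal-period y₁+y₂≡2b
  where
  open LengyelGame b x₁ y₁ x₂ y₂
  open Terminating 0<b 0<x₁ 0<x₂ y₁<2b y₂<2b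
  diagonal : DiagonalPeriodic b x₁ y₁ x₂ y₂
  diagonal x y y₁+y₂≤y rewrite y₁+y₂≡2b = cong star (begin
    sg x y                          ≡⟨ cong (sg x) (m∸n+n≡m y₁+y₂≤y) ⟨
    sg x (y ∸ 2 * b + 2 * b)        ≡⟨ vertical-period x (y ∸ 2 * b) ⟩
    sg x (y ∸ 2 * b)                ≡⟨ horizontal-period y₁+y₂≡2b x (y ∸ 2 * b) ⟨
    sg (x + (x₁ + x₂)) (y ∸ 2 * b)  ∎)
    where open ≡-Reasoning
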